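{- Let $G$ be a graph, $B\subseteq V(G)$, and $S$ a vertex cover of $G$ with $B\subseteq S$ and $|S|=\delta(G-B)+p$ for some integer $p\ge 0$. Let $k\ge 0$ be an integer and let $X\subseteq I=V(G)\setminus S$ with $|X|=\delta(G-B)-3p$. If $G$ has a cycle $C$ of length $2\delta(G-B)+k$, then $G$ has a cycle $C'$ of length $2\delta(G-B)+k$ that contains all vertices of $X$ and satisfies $V(C)\cap S=V(C')\cap S$.
   Context: Graphs are finite, simple, undirected; $G-B$ is the subgraph induced by $V(G)\setminus B$; $\delta$ denotes minimum degree; cycle length is number of edges. A vertex cover is a vertex set meeting every edge. -}

module Defs where

open import Data.Nat using (ℕ; _≤_)
open import Data.Bool using (Bool; true; false)
open import Data.Fin using (Fin; toℕ)
open import Data.Fin.Subset using (Subset; _∈_; _∉_; _∩_; ∁; ∣_∣)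
open import Data.Vec using (tabulate)
open import Data.Sum using (_⊎_)
open import Data.Product using (∃; _×_)
open import Function.Definitions using (Injective)
open import Relation.Binary.PropositionalEquality using (_≡_)

record Graph (n : ℕ) : Set where
  field
    adj    : Fin n → Fin n → Bool
    sym    : ∀ u v → adj u v ≡ adj v u
    irrefl : ∀ v → adj v v ≡ false

open Graph public

Edge : ∀ {n} → Graph n → Fin n → Fin n → Set
Edge G u v = adj G u v ≡ true

N : ∀ {n} → Graph n → Fin n → Subset n
N G v = tabulate (λ u → adj G v u)

-- Degree of v in G - B (the subgraph induced by V(G) \ B).
degMinus : ∀ {n} → Graph n → Subset n → Fin n → ℕ
degMinus G B v = ∣ N G v ∩ ∁ B ∣

IsMinDegMinus : ∀ {n} → Graph n → Subset n → ℕ → Set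
IsMinDegMinus G B d =
  (∃ λ v → v ∉ B × degMinus G B v ≡ d) × (∀ v → v ∉ B → d ≤ degMinus G B v)

VertexCover : ∀ {n} → Graph n → Subset n → Set
VertexCover G S = ∀ u v → Edge G u v → (u ∈ S) ⊎ (v ∈ S)

-- A cycle of length ℓ (= number of edges = number of vertices), ℓ ≥ 3:
-- distinct vertices vert 0, …, vert (ℓ-1) with consecutive ones adjacent
-- and vert (ℓ-1) adjacent to vert 0.
record Cycle {n} (G : Graph n) (ℓ : ℕ) : Set where
  field
    3≤ℓ    : 3 ≤ ℓ
    vert   : Fin ℓ → Fin n
    inj    : Injective _≡_ _≡_ vert
    step   : ∀ (i j : Fin ℓ) → Data.Nat.suc (toℕ i) ≡ toℕ j → Edge G (vert i) (vert j)
    close  : ∀ (i j : Fin ℓ) → Data.Nat.suc (toℕ i) ≡ ℓ → toℕ j ≡ 0 → Edge G (vert i) (vert j)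

open Cycle public

OnCycle : ∀ {n} {G : Graph n} {ℓ} → Cycle G ℓ → Fin n → Set
OnCycle C v = ∃ λ i → vert C i ≡ v

{-# OPTIONS --safe #-}
module Submission where

open import Defs hiding (sym)
open import Data.Nat using (ℕ; zero; suc; _+_; _*_; _≤_; _<_; z≤n; s≤s)
open import Data.Nat.Properties
  using (≤-trans; ≤-reflexive; n≮n; <⇒≱; ≤-<-trans; suc-injective;
         +-suc; +-monoʳ-≤; +-monoˡ-≤; *-monoʳ-≤; +-mono-≤; +-monoʳ-<; +-monoˡ-<; +-cancelˡ-≤; m≤m+n;
         module ≤-Reasoning)
open import Data.Nat.Tactic.RingSolver using (solve-∀)
open import Data.Fin using (Fin; zero; suc; toℕ; fromℕ; inject₁)
open import Data.Fin.Properties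
  using (toℕ-fromℕ; toℕ-inject₁; toℕ<n; toℕ-injective; 0≢1+n; any?; ¬∀⟶∃¬)
  renaming (suc-injective to Fin-suc-injective; _≟_ to _≟ᶠ_)
open import Data.Fin.Relation.Unary.Top using (view; ‵fromℕ; ‵inj₁; ‵inject₁)
open import Data.Fin.Subset using (Subset; inside; outside; _∈_; _∉_; _⊆_; ∁; _∩_; _∪_; _-_; ⊤; ∣_∣)
open import Data.Fin.Subset.Properties
  using (_∈?_; p⊆q⇒∣p∣≤∣q∣; ∣p∣≤∣x∷p∣; ∣⊤∣≡n; ∣p∩q∣≤∣p∣; x∈p⇒∣p-x∣<∣p∣; x∈p∧x≢y⇒x∈p-y;
         x∈p∩q⁺; x∈p∪q⁺; x∈∁p⇒x∉p; x∉∁p⇒x∈p)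
open import Data.List using (List; []; _∷_; allFin)
open import Data.List.Membership.Propositional using () renaming (_∈_ to _∈ˡ_)
open import Data.List.Membership.Propositional.Properties using (∈-allFin)
open import Data.List.Relation.Unary.Any using (here; there)
open import Data.Product using (Σ; ∃; _×_; _,_; proj₁; proj₂)
open import Data.Sum using (inj₁; inj₂)
open import Data.Vec using ([]; _∷_; lookup; tabulate)
open import Data.Vec.Properties using ([]=⇒lookup; lookup⇒[]=; lookup∘tabulate)
open import Data.Vec.Functional using (updateAt)
open import Data.Vec.Functional.Properties using (updateAt-updates; updateAt-minimal)
open import Function using (_∘_; const)
open import Function.Bundles using (_⇔_; mk⇔)
open import Function.Construct.Identity using (⇔-id)
open import Function.Construct.Composition using (_⇔-∘_)
open import Function.Definitions using (Injective)
open import Relation.Nullary using (yes; no; ¬_; contradiction)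
open import Relation.Binary.PropositionalEquality
  using (_≡_; _≢_; refl; sym; trans; cong; subst; subst₂)

-- Let ℓ = 2δ + k and let x ∈ X be missing from C. As x ∉ S and S is a vertex
-- cover, N(x) ⊆ S, so Q = S ∖ N(x) has |Q| ≤ |S| − δ ≤ p. The vertex at a cycle
-- position can be swapped for x if it lies outside S ∪ X and both its cycle
-- neighbours are adjacent to x. A position outside S failing this is charged to
-- X ∖ {x} or to a cycle neighbour in Q (neighbours of a vertex outside the cover
-- lie in S), so at most |S| + |X| − 1 + 2p = 2δ − 1 < ℓ positions are bad. The
-- swap keeps the length, V(C) ∩ S and V(C) ∩ X; repeat for every vertex of X.

private
  variable
    m n ℓ : ℕ

∣p∪q∣≤∣p∣+∣q∣ : ∀ (p q : Subset n) → ∣ p ∪ q ∣ ≤ ∣ p ∣ + ∣ q ∣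
∣p∪q∣≤∣p∣+∣q∣ []            []            = z≤n
∣p∪q∣≤∣p∣+∣q∣ (inside  ∷ p) (s       ∷ q) =
  s≤s (≤-trans (∣p∪q∣≤∣p∣+∣q∣ p q) (+-monoʳ-≤ ∣ p ∣ (∣p∣≤∣x∷p∣ s q)))
∣p∪q∣≤∣p∣+∣q∣ (outside ∷ p) (outside ∷ q) = ∣p∪q∣≤∣p∣+∣q∣ p q
∣p∪q∣≤∣p∣+∣q∣ (outside ∷ p) (inside  ∷ q) =
  ≤-trans (s≤s (∣p∪q∣≤∣p∣+∣q∣ p q)) (≤-reflexive (sym (+-suc ∣ p ∣ ∣ q ∣)))

∣p∩q∣+∣p∩∁q∣≡∣p∣ : ∀ (p q : Subset n) → ∣ p ∩ q ∣ + ∣ p ∩ ∁ q ∣ ≡ ∣ p ∣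
∣p∩q∣+∣p∩∁q∣≡∣p∣ []            []            = refl
∣p∩q∣+∣p∩∁q∣≡∣p∣ (outside ∷ p) (_       ∷ q) = ∣p∩q∣+∣p∩∁q∣≡∣p∣ p q
∣p∩q∣+∣p∩∁q∣≡∣p∣ (inside  ∷ p) (inside  ∷ q) = cong suc (∣p∩q∣+∣p∩∁q∣≡∣p∣ p q)
∣p∩q∣+∣p∩∁q∣≡∣p∣ (inside  ∷ p) (outside ∷ q) =
  trans (+-suc ∣ p ∩ q ∣ ∣ p ∩ ∁ q ∣) (cong suc (∣p∩q∣+∣p∩∁q∣≡∣p∣ p q))

∣p∣<n⇒∃∉p : ∀ (p : Subset n) → ∣ p ∣ < n → ∃ λ x → x ∉ p
∣p∣<n⇒∃∉p {n} p ∣p∣<n = ¬∀⟶∃¬ n (_∈ p) (_∈? p) λ ∀∈p →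
  <⇒≱ ∣p∣<n (≤-trans (≤-reflexive (sym (∣⊤∣≡n n))) (p⊆q⇒∣p∣≤∣q∣ {p = ⊤} (λ _ → ∀∈p _)))

x∈p∧x∉p∩∁q⇒x∈q : ∀ {x : Fin n} {p q} → x ∈ p → x ∉ p ∩ ∁ q → x ∈ q
x∈p∧x∉p∩∁q⇒x∈q x∈p x∉p∩∁q = x∉∁p⇒x∈p (λ x∈∁q → x∉p∩∁q (x∈p∩q⁺ (x∈p , x∈∁q)))

preimage : (Fin m → Fin n) → Subset n → Subset m
preimage f p = tabulate (lookup p ∘ f)

∈-preimage⁺ : ∀ (f : Fin m → Fin n) {p i} → f i ∈ p → i ∈ preimage f p
∈-preimage⁺ f {p} {i} fi∈p =
  lookup⇒[]= i _ (trans (lookup∘tabulate (lookup p ∘ f) i) ([]=⇒lookup fi∈p))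

∈-preimage⁻ : ∀ (f : Fin m → Fin n) p {i} → i ∈ preimage f p → f i ∈ p
∈-preimage⁻ f p {i} i∈ =
  lookup⇒[]= (f i) p (trans (sym (lookup∘tabulate (lookup p ∘ f) i)) ([]=⇒lookup i∈))

∣preimage∣≤∣p∣ : ∀ {f : Fin m → Fin n} → Injective _≡_ _≡_ f → ∀ p → ∣ preimage f p ∣ ≤ ∣ p ∣
∣preimage∣≤∣p∣ {zero}  f-inj p = z≤n
∣preimage∣≤∣p∣ {suc m} {f = f} f-inj p with lookup p (f zero) in f0∈p
... | outside = ∣preimage∣≤∣p∣ (Fin-suc-injective ∘ f-inj) p
... | inside  = begin-strict
  ∣ preimage (f ∘ suc) p ∣            ≤⟨ p⊆q⇒∣p∣≤∣q∣ tail⊆ ⟩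
  ∣ preimage (f ∘ suc) (p - f zero) ∣ ≤⟨ ∣preimage∣≤∣p∣ (Fin-suc-injective ∘ f-inj) (p - f zero) ⟩
  ∣ p - f zero ∣                      <⟨ x∈p⇒∣p-x∣<∣p∣ (lookup⇒[]= (f zero) p f0∈p) ⟩
  ∣ p ∣                               ∎
  where
  open ≤-Reasoning
  tail⊆ : preimage (f ∘ suc) p ⊆ preimage (f ∘ suc) (p - f zero)
  tail⊆ i∈ = ∈-preimage⁺ (f ∘ suc) (x∈p∧x≢y⇒x∈p-y (∈-preimage⁻ (f ∘ suc) p i∈) (0≢1+n ∘ f-inj ∘ sym))

next : Fin ℓ → Fin ℓ
next {suc m} i with view i
... | ‵fromℕ     = zero
... | ‵inject₁ j = suc j

next-injective : Injective _≡_ _≡_ (next {ℓ})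
next-injective {suc m} {i} {j} with view i | view j
... | ‵fromℕ  | ‵fromℕ  = λ _ → refl
... | ‵inj₁ _ | ‵inj₁ _ = cong inject₁ ∘ Fin-suc-injective
... | ‵fromℕ  | ‵inj₁ _ = λ ()
... | ‵inj₁ _ | ‵fromℕ  = λ ()

next-step : ∀ {i j : Fin ℓ} → suc (toℕ i) ≡ toℕ j → next i ≡ j
next-step {suc m} {i} {j} with view i
... | ‵fromℕ = λ i+1≡j →
  contradiction (subst (_< suc m) (trans (sym i+1≡j) (cong suc (toℕ-fromℕ m))) (toℕ<n j)) (n≮n (suc m))
... | ‵inject₁ a = λ i+1≡j → toℕ-injective (trans (cong suc (sym (toℕ-inject₁ a))) i+1≡j)

next-close : ∀ {i j : Fin ℓ} → suc (toℕ i) ≡ ℓ → toℕ j ≡ 0 → next i ≡ j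
next-close {suc m} {i} {j} with view i
... | ‵fromℕ     = λ _ j≡0 → toℕ-injective (sym j≡0)
... | ‵inject₁ a = λ i+1≡ℓ _ →
  contradiction (subst (_< m) (trans (sym (toℕ-inject₁ a)) (suc-injective i+1≡ℓ)) (toℕ<n a)) (n≮n m)

module _ {G : Graph n} where

  edge-irrefl : ∀ {v} → ¬ Edge G v v
  edge-irrefl {v} e with trans (sym e) (irrefl G v)
  ... | ()

  edge-sym : ∀ {u v} → Edge G u v → Edge G v u
  edge-sym {u} {v} e = trans (Graph.sym G v u) e

  ∈N⇒Edge : ∀ {x v} → v ∈ N G x → Edge G x v
  ∈N⇒Edge {x} {v} v∈N = trans (sym (lookup∘tabulate (adj G x) v)) ([]=⇒lookup v∈N)

  cover-∉⇒∈ : ∀ {S u v} → VertexCover G S → Edge G u v → u ∉ S → v ∈ S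
  cover-∉⇒∈ {u = u} {v} cover e u∉S with cover u v e
  ... | inj₁ u∈S = contradiction u∈S u∉S
  ... | inj₂ v∈S = v∈S

  ∣N∣+∣S∩∁N∣≤∣S∣ : ∀ {S x} → VertexCover G S → x ∉ S → ∣ N G x ∣ + ∣ S ∩ ∁ (N G x) ∣ ≤ ∣ S ∣
  ∣N∣+∣S∩∁N∣≤∣S∣ {S} {x} cover x∉S = ≤-trans
    (+-monoˡ-≤ ∣ S ∩ ∁ (N G x) ∣ (p⊆q⇒∣p∣≤∣q∣ N⊆S∩N))
    (≤-reflexive (∣p∩q∣+∣p∩∁q∣≡∣p∣ S (N G x)))
    where
    N⊆S∩N : N G x ⊆ S ∩ N G x
    N⊆S∩N v∈N = x∈p∩q⁺ (cover-∉⇒∈ cover (∈N⇒Edge v∈N) x∉S , v∈N)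

  edge-next : (C : Cycle G ℓ) (i : Fin ℓ) → Edge G (vert C i) (vert C (next i))
  edge-next {suc m} C i with view i
  ... | ‵fromℕ     = close C (fromℕ m) zero (cong suc (toℕ-fromℕ m)) refl
  ... | ‵inject₁ j = step C (inject₁ j) (suc j) (cong suc (toℕ-inject₁ j))

  next≢ : Cycle G ℓ → (i : Fin ℓ) → next i ≢ i
  next≢ C i next≡i = edge-irrefl (subst (Edge G (vert C i) ∘ vert C) next≡i (edge-next C i))

  mkCycle : 3 ≤ ℓ → (f : Fin ℓ → Fin n) → Injective _≡_ _≡_ f →
            (∀ i → Edge G (f i) (f (next i))) → Cycle G ℓ
  mkCycle 3≤ℓ f f-inj edge = record
    { 3≤ℓ   = 3≤ℓ
    ; vert  = f
    ; inj   = f-inj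
    ; step  = λ i j i+1≡j → subst (Edge G (f i) ∘ f) (next-step i+1≡j) (edge i)
    ; close = λ i j i+1≡ℓ j≡0 → subst (Edge G (f i) ∘ f) (next-close i+1≡ℓ j≡0) (edge i)
    }

  SameOn : Subset n → Cycle G ℓ → Cycle G ℓ → Set
  SameOn S C C' = ∀ v → v ∈ S → (OnCycle C v ⇔ OnCycle C' v)

  record Retains (S X : Subset n) (C C' : Cycle G ℓ) : Set where
    constructor retains
    field
      keepsX : ∀ v → v ∈ X → OnCycle C v → OnCycle C' v
      sameOn : SameOn S C C'

  open Retains

  Retains-refl : ∀ {S X} {C : Cycle G ℓ} → Retains S X C C
  Retains-refl = retains (λ _ _ v∈C → v∈C) (λ _ _ → ⇔-id _)

  Retains-trans : ∀ {S X} {C₁ C₂ C₃ : Cycle G ℓ} →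
                  Retains S X C₁ C₂ → Retains S X C₂ C₃ → Retains S X C₁ C₃
  Retains-trans (retains X₁₂ S₁₂) (retains X₂₃ S₂₃) =
    retains (λ v v∈X → X₂₃ v v∈X ∘ X₁₂ v v∈X) (λ v v∈S → S₂₃ v v∈S ⇔-∘ S₁₂ v v∈S)

  module Replace (C : Cycle G ℓ) (j : Fin ℓ) (x : Fin n) (x∉C : ¬ OnCycle C x)
                 (pred-edge : Edge G (vert C j) x) (succ-edge : Edge G x (vert C (next (next j)))) where

    private
      r : Fin ℓ
      r = next j

      f : Fin ℓ → Fin n
      f = updateAt (vert C) r (const x)

      f-r : f r ≡ x
      f-r = updateAt-updates r (vert C)

      f-i : ∀ {i} → i ≢ r → f i ≡ vert C i
      f-i {i} i≢r = updateAt-minimal i r (vert C) i≢r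

      f-inj : Injective _≡_ _≡_ f
      f-inj {a} {b} fa≡fb with a ≟ᶠ r | b ≟ᶠ r
      ... | yes refl | yes refl = refl
      ... | yes refl | no  b≢r  = contradiction (b , trans (sym (f-i b≢r)) (trans (sym fa≡fb) f-r)) x∉C
      ... | no  a≢r  | yes refl = contradiction (a , trans (sym (f-i a≢r)) (trans fa≡fb f-r)) x∉C
      ... | no  a≢r  | no  b≢r  = inj C (trans (sym (f-i a≢r)) (trans fa≡fb (f-i b≢r)))

      f-edge : ∀ i → Edge G (f i) (f (next i))
      f-edge i with i ≟ᶠ r | next i ≟ᶠ r
      ... | yes refl | _          = subst₂ (Edge G) (sym f-r) (sym (f-i (next≢ C i))) succ-edge
      ... | no  i≢r  | yes i+1≡r  = subst₂ (Edge G) (sym (f-i i≢r)) (sym (trans (cong f i+1≡r) f-r))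
          (subst (λ i → Edge G (vert C i) x) (sym (next-injective i+1≡r)) pred-edge)
      ... | no  i≢r  | no  i+1≢r  = subst₂ (Edge G) (sym (f-i i≢r)) (sym (f-i i+1≢r)) (edge-next C i)

    replace : Cycle G ℓ
    replace = mkCycle (3≤ℓ C) f f-inj f-edge

    x∈replace : OnCycle replace x
    x∈replace = r , f-r

    ∈replace⁺ : ∀ {v} → OnCycle C v → v ≢ vert C (next j) → OnCycle replace v
    ∈replace⁺ (i , refl) v≢r with i ≟ᶠ r
    ... | yes refl = contradiction refl v≢r
    ... | no  i≢r  = i , f-i i≢r

    ∈replace⁻ : ∀ {v} → OnCycle replace v → v ≢ x → OnCycle C v
    ∈replace⁻ (i , refl) v≢x with i ≟ᶠ r
    ... | yes refl = contradiction f-r v≢x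
    ... | no  i≢r  = i , sym (f-i i≢r)

    replace-retains : ∀ {S X} → x ∉ S → vert C (next j) ∉ S → vert C (next j) ∉ X → Retains S X C replace
    replace-retains {S} {X} x∉S r∉S r∉X = retains
      (λ v v∈X v∈C → ∈replace⁺ v∈C λ v≡r → r∉X (subst (_∈ X) v≡r v∈X))
      (λ v v∈S → mk⇔ (λ v∈C → ∈replace⁺ v∈C λ v≡r → r∉S (subst (_∈ S) v≡r v∈S))
                     (λ v∈C' → ∈replace⁻ v∈C' λ v≡x → x∉S (subst (_∈ S) v≡x v∈S)))

  replaceable-position :
    ∀ {S} → VertexCover G S → (C : Cycle G ℓ) (x : Fin n) (T : Subset n) →
    ∣ S ∣ + ∣ T ∣ + 2 * ∣ S ∩ ∁ (N G x) ∣ < ℓ →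
    ∃ λ j → vert C (next j) ∉ S × vert C (next j) ∉ T
          × Edge G (vert C j) x × Edge G x (vert C (next (next j)))
  replaceable-position {ℓ} {S} cover C x T bound =
    j , V₁∉S , V₁∉T , edge-sym (∈N⇒Edge V₀∈N) , ∈N⇒Edge V₂∈N
    where
    V = vert C
    Q = S ∩ ∁ (N G x)
    V₁-inj : Injective _≡_ _≡_ (V ∘ next)
    V₁-inj = next-injective ∘ inj C
    V₂-inj : Injective _≡_ _≡_ (V ∘ next ∘ next)
    V₂-inj = next-injective ∘ V₁-inj
    S₁ T₁ Q₀ Q₂ U : Subset ℓ
    S₁ = preimage (V ∘ next) S
    T₁ = preimage (V ∘ next) T
    Q₀ = preimage V Q
    Q₂ = preimage (V ∘ next ∘ next) Q
    -- At a position j ∉ U, V (next j) ∉ S, so its cycle neighbours V j and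
    -- V (next (next j)) lie in the cover S; being outside Q, they lie in N(x).
    U = S₁ ∪ T₁ ∪ Q₀ ∪ Q₂
    reassoc : ∀ a b c → a + (b + (c + c)) ≡ a + b + 2 * c
    reassoc = solve-∀
    open ≤-Reasoning
    ∣U∣<ℓ : ∣ U ∣ < ℓ
    ∣U∣<ℓ = ≤-<-trans (begin
      ∣ U ∣
        ≤⟨ ∣p∪q∣≤∣p∣+∣q∣ S₁ _ ⟩
      ∣ S₁ ∣ + ∣ T₁ ∪ Q₀ ∪ Q₂ ∣
        ≤⟨ +-monoʳ-≤ (∣ S₁ ∣) (≤-trans (∣p∪q∣≤∣p∣+∣q∣ T₁ _) (+-monoʳ-≤ (∣ T₁ ∣) (∣p∪q∣≤∣p∣+∣q∣ Q₀ Q₂))) ⟩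
      ∣ S₁ ∣ + (∣ T₁ ∣ + (∣ Q₀ ∣ + ∣ Q₂ ∣))
        ≤⟨ +-mono-≤ (∣preimage∣≤∣p∣ V₁-inj S) (+-mono-≤ (∣preimage∣≤∣p∣ V₁-inj T)
             (+-mono-≤ (∣preimage∣≤∣p∣ (inj C) Q) (∣preimage∣≤∣p∣ V₂-inj Q))) ⟩
      ∣ S ∣ + (∣ T ∣ + (∣ Q ∣ + ∣ Q ∣))
        ≡⟨ reassoc (∣ S ∣) (∣ T ∣) (∣ Q ∣) ⟩
      ∣ S ∣ + ∣ T ∣ + 2 * ∣ Q ∣ ∎) bound
    j = proj₁ (∣p∣<n⇒∃∉p U ∣U∣<ℓ)
    j∉U = proj₂ (∣p∣<n⇒∃∉p U ∣U∣<ℓ)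
    V₁∉S : V (next j) ∉ S
    V₁∉S = j∉U ∘ x∈p∪q⁺ ∘ inj₁ ∘ ∈-preimage⁺ (V ∘ next)
    V₁∉T : V (next j) ∉ T
    V₁∉T = j∉U ∘ x∈p∪q⁺ ∘ inj₂ ∘ x∈p∪q⁺ ∘ inj₁ ∘ ∈-preimage⁺ (V ∘ next)
    V₀∈N : V j ∈ N G x
    V₀∈N = x∈p∧x∉p∩∁q⇒x∈q (cover-∉⇒∈ cover (edge-sym (edge-next C j)) V₁∉S)
             (j∉U ∘ x∈p∪q⁺ ∘ inj₂ ∘ x∈p∪q⁺ ∘ inj₂ ∘ x∈p∪q⁺ ∘ inj₁ ∘ ∈-preimage⁺ V)
    V₂∈N : V (next (next j)) ∈ N G x
    V₂∈N = x∈p∧x∉p∩∁q⇒x∈q (cover-∉⇒∈ cover (edge-next C (next j)) V₁∉S)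
             (j∉U ∘ x∈p∪q⁺ ∘ inj₂ ∘ x∈p∪q⁺ ∘ inj₂ ∘ x∈p∪q⁺ ∘ inj₂ ∘ ∈-preimage⁺ (V ∘ next ∘ next))

  absorb : ∀ {S X x} → VertexCover G S → (C : Cycle G ℓ) → x ∉ S → ¬ OnCycle C x →
           ∣ S ∣ + ∣ X - x ∣ + 2 * ∣ S ∩ ∁ (N G x) ∣ < ℓ →
           Σ (Cycle G ℓ) λ C' → OnCycle C' x × Retains S X C C'
  absorb {X = X} {x} cover C x∉S x∉C bound =
    let j , r∉S , r∉X-x , pred~x , x~succ = replaceable-position cover C x (X - x) bound
        r∉X = λ r∈X → r∉X-x (x∈p∧x≢y⇒x∈p-y r∈X (x∉C ∘ (next j ,_)))
        open Replace C j x x∉C pred~x x~succ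
    in  replace , x∈replace , replace-retains x∉S r∉S r∉X

  absorb-all : ∀ {S X} →
    (∀ (C : Cycle G ℓ) x → x ∈ X → ¬ OnCycle C x →
       Σ (Cycle G ℓ) λ C' → OnCycle C' x × Retains S X C C') →
    (C : Cycle G ℓ) → Σ (Cycle G ℓ) λ C' → (∀ x → x ∈ X → OnCycle C' x) × SameOn S C C'
  absorb-all {ℓ = ℓ} {S = S} {X} absorb-X C =
    let C' , C⊑C' , all⊆C' = absorb-list (allFin n)
    in  C' , (λ x x∈X → all⊆C' x x∈X (∈-allFin x)) , sameOn C⊑C'
    where
    absorb-one : ∀ (C₁ : Cycle G ℓ) y →
                 Σ (Cycle G ℓ) λ C₂ → Retains S X C₁ C₂ × (y ∈ X → OnCycle C₂ y)
    absorb-one C₁ y with y ∈? X | any? (λ i → vert C₁ i ≟ᶠ y)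
    ... | no  y∉X | _        = C₁ , Retains-refl , λ y∈X → contradiction y∈X y∉X
    ... | yes _   | yes y∈C₁ = C₁ , Retains-refl , const y∈C₁
    ... | yes y∈X | no  y∉C₁ with absorb-X C₁ y y∈X y∉C₁
    ...   | C₂ , y∈C₂ , C₁⊑C₂ = C₂ , C₁⊑C₂ , const y∈C₂

    absorb-list : (L : List (Fin n)) →
      Σ (Cycle G ℓ) λ C' → Retains S X C C' × (∀ x → x ∈ X → x ∈ˡ L → OnCycle C' x)
    absorb-list []      = C , Retains-refl , λ _ _ ()
    absorb-list (y ∷ L) with absorb-list L
    ... | C₁ , C⊑C₁ , L⊆C₁ with absorb-one C₁ y
    ...   | C₂ , C₁⊑C₂ , y⊆C₂ = C₂ , Retains-trans C⊑C₁ C₁⊑C₂ , λ where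
      x x∈X (here refl)  → y⊆C₂ x∈X
      x x∈X (there x∈L) → keepsX C₁⊑C₂ x x∈X (L⊆C₁ x x∈X x∈L)

length-bound : ∀ {d p k s t c nx q} → s ≡ d + p → t + 3 * p ≡ d → c < t → d ≤ nx → nx + q ≤ s →
               s + c + 2 * q < 2 * d + k
length-bound {d} {p} {k} {s} {t} {c} {nx} {q} s≡d+p t+3p≡d c<t d≤nx nx+q≤s = begin-strict
  s + c + 2 * q     ≤⟨ +-monoʳ-≤ (s + c) (*-monoʳ-≤ 2 q≤p) ⟩
  s + c + 2 * p     <⟨ +-monoˡ-< (2 * p) (+-monoʳ-< s c<t) ⟩
  s + t + 2 * p     ≡⟨ cong (λ s → s + t + 2 * p) s≡d+p ⟩
  d + p + t + 2 * p ≡⟨ regroup d p t ⟩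
  d + (t + 3 * p)   ≡⟨ cong (d +_) t+3p≡d ⟩
  d + d             ≡⟨ double d ⟩
  2 * d             ≤⟨ m≤m+n (2 * d) k ⟩
  2 * d + k         ∎
  where
  open ≤-Reasoning
  q≤p : q ≤ p
  q≤p = +-cancelˡ-≤ d q p (≤-trans (+-monoˡ-≤ q d≤nx) (≤-trans nx+q≤s (≤-reflexive s≡d+p)))
  regroup : ∀ d p t → d + p + t + 2 * p ≡ d + (t + 3 * p)
  regroup = solve-∀
  double : ∀ d → d + d ≡ 2 * d
  double = solve-∀

lemma31 : ∀ {n} (G : Graph n) (B S : Subset n) (d p k : ℕ) →
    IsMinDegMinus G B d →
    VertexCover G S → B ⊆ S → ∣ S ∣ ≡ d + p →
    (X : Subset n) → X ⊆ ∁ S → ∣ X ∣ + 3 * p ≡ d →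
    (C : Cycle G (2 * d + k)) →
    Σ (Cycle G (2 * d + k)) λ C' →
      (∀ x → x ∈ X → OnCycle C' x)
    × (∀ v → v ∈ S → (OnCycle C v ⇔ OnCycle C' v))
lemma31 G B S d p k (_ , d≤deg) cover B⊆S ∣S∣≡d+p X X⊆∁S ∣X∣+3p≡d = absorb-all absorb-X
  where
  absorb-X : ∀ (C : Cycle G (2 * d + k)) x → x ∈ X → ¬ OnCycle C x →
             Σ (Cycle G (2 * d + k)) λ C' → OnCycle C' x × Retains S X C C'
  absorb-X C x x∈X x∉C = absorb cover C x∉S x∉C
    (length-bound ∣S∣≡d+p ∣X∣+3p≡d (x∈p⇒∣p-x∣<∣p∣ x∈X) d≤∣N∣ (∣N∣+∣S∩∁N∣≤∣S∣ {G = G} cover x∉S))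
    where
    x∉S : x ∉ S
    x∉S = x∈∁p⇒x∉p (X⊆∁S x∈X)
    d≤∣N∣ : d ≤ ∣ N G x ∣
    d≤∣N∣ = ≤-trans (d≤deg x (x∉S ∘ B⊆S)) (∣p∩q∣≤∣p∣ (N G x) (∁ B))
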